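{- Let $t$ be the Thue–Morse word, the fixed point starting with $a$ of the morphism $a\mapsto abba$, $b\mapsto baab$. For $k\ge 1$ let $SP_t(k)$ be the smallest $n$ such that $PPL_t(n)=k$. Then $SP_t(1)=1$, $SP_t(2)=2$, $SP_t(3)=6$, and for all $k>0$, \[SP_t(k+3)=16\,SP_t(k)-6.\]
   Context: $PPL_t(n)$ is the minimal number of palindromes whose concatenation is the prefix of $t$ of length $n$. -}

module Defs where

open import Data.Nat using (ℕ; zero; suc; _≤_)
open import Data.List using (List; []; _∷_; concat; concatMap; reverse; length; map; upTo; lookup)
open import Data.List.Relation.Unary.All using (All)
open import Data.Product using (Σ; _×_; ∃)
open import Data.Maybe using (Maybe; just; nothing)
open import Relation.Binary.PropositionalEquality using (_≡_)

data Letter : Set where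
  a b : Letter

μ : Letter → List Letter
μ a = a ∷ b ∷ b ∷ a ∷ []
μ b = b ∷ a ∷ a ∷ b ∷ []

μ* : List Letter → List Letter
μ* = concatMap μ

iter : ℕ → List Letter
iter zero = a ∷ []
iter (suc k) = μ* (iter k)

_!!_ : {A : Set} → List A → ℕ → Maybe A
[] !! _ = nothing
(x ∷ xs) !! zero = just x
(x ∷ xs) !! suc n = xs !! n

-- The Thue–Morse word t (fixed point of μ starting with a):
-- t(n) is the n-th letter of μ^(n+1)(a), whose length 4^(n+1) exceeds n.
t : ℕ → Letter
t n with iter (suc n) !! n
... | just x = x
... | nothing = a   -- never happens

prefix : ℕ → List Letter
prefix n = map t (upTo n)

Palindrome : List Letter → Set
Palindrome w = reverse w ≡ w

PalFact : List Letter → ℕ → Set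
PalFact w k = Σ (List (List Letter)) λ ws →
  All Palindrome ws × concat ws ≡ w × length ws ≡ k

PPL : ℕ → ℕ → Set
PPL n k = PalFact (prefix n) k × (∀ j → PalFact (prefix n) j → k ≤ j)

SP : ℕ → ℕ → Set
SP k n = PPL n k × (∀ m → PPL m k → n ≤ m)

module Submission where

-- Palindromic factors t[i, i + L) are handled through their positions (Pal),
-- and "Fac N j" says that the prefix of length N is a product of j palindromes,
-- empty ones allowed (as in PalFact); the two descriptions agree and Fac is
-- decidable.  The argument rests on three facts about t:
--   * t(4q + r) equals t(q) for r = 0, 3 and its complement for r = 1, 2;
--   * every nonempty palindromic factor has one of a few shapes: a letter, a
--     length 3 factor at a position ≡ 2, 3 (mod 4), a length ≡ 0 (mod 4)
--     factor at an even position, or a length ≡ 2 (mod 4) one at an odd one;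
--   * images of palindromes under μ (possibly trimmed) are palindromes, and
--     palindromes of these shapes come from palindromes one level down.
-- Hence factorizations lift from length m to 4m + r (lift₀ … lift₃) and
-- descend from 4m + r to m or m + 1 (descend).  With n = SP(k), descending
-- twice from 16n − 6 = 4(4(n − 1) + 2) + 2 shows that it needs k + 3
-- palindromes, and lifting twice shows every shorter prefix needs at most k + 2.

open import Defs
open import Data.Nat using (ℕ; zero; suc; _+_; _*_; _∸_; _≤_; _<_; z≤n; s≤s; _≤?_; _<?_; >-nonZero)
open import Data.Nat.Properties
open import Data.Nat.DivMod using (_%_; _/_; m≡m%n+[m/n]*n; m%n<n; [m+kn]%n≡m%n; m<n⇒m%n≡m)
open import Data.Nat.Tactic.RingSolver using (solve-∀)
open import Data.List using (List; []; _∷_; _++_; concat; length; map; reverse; replicate; applyUpTo)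
open import Data.List.Properties
  using (concatMap-++; concat-++; ++-identityʳ; length-++; length-replicate; length-reverse; reverse-++; unfold-reverse; ∷-injective)
  renaming (≡-dec to list-≟)
open import Data.List.Relation.Unary.All using (All; []; _∷_)
open import Data.List.Relation.Unary.All.Properties using (++⁺; replicate⁺)
open import Data.Maybe using (just; nothing)
open import Data.Maybe.Properties using (just-injective)
open import Data.Product using (Σ; ∃-syntax; _×_; _,_; proj₁)
open import Data.Sum using (_⊎_; inj₁; inj₂) renaming (map to ⊎-map)
open import Data.Empty using (⊥; ⊥-elim)
open import Function using (_∘_; id)
open import Relation.Nullary using (Dec; yes; no; ¬_; contradiction)
open import Relation.Nullary.Decidable using (map′; _×-dec_)
open import Relation.Binary.PropositionalEquality

0<4 : 0 < 4
0<4 = s≤s z≤n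

1<4 : 1 < 4
1<4 = s≤s (s≤s z≤n)

2<4 : 2 < 4
2<4 = s≤s (s≤s (s≤s z≤n))

3<4 : 3 < 4
3<4 = s≤s (s≤s (s≤s (s≤s z≤n)))

div4-unique : ∀ {r r′ m n} → r < 4 → r′ < 4 → r + m * 4 ≡ r′ + n * 4 → r ≡ r′ × m ≡ n
div4-unique {r} {r′} {m} {n} r<4 r′<4 e =
  same-rem , *-cancelʳ-≡ m n 4 (+-cancelˡ-≡ r _ _ (trans e (cong (_+ n * 4) (sym same-rem))))
  where
  same-rem : r ≡ r′
  same-rem = begin
    r                ≡⟨ sym (m<n⇒m%n≡m r<4) ⟩
    r % 4            ≡⟨ sym ([m+kn]%n≡m%n r m 4) ⟩
    (r + m * 4) % 4  ≡⟨ cong (_% 4) e ⟩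
    (r′ + n * 4) % 4 ≡⟨ [m+kn]%n≡m%n r′ n 4 ⟩
    r′ % 4           ≡⟨ m<n⇒m%n≡m r′<4 ⟩
    r′               ∎
    where open ≡-Reasoning

data Mod4 : ℕ → Set where
  r0 : ∀ q → Mod4 (q * 4)
  r1 : ∀ q → Mod4 (1 + q * 4)
  r2 : ∀ q → Mod4 (2 + q * 4)
  r3 : ∀ q → Mod4 (3 + q * 4)

mod4 : ∀ n → Mod4 n
mod4 zero = r0 0
mod4 (suc n) with mod4 n
... | r0 q = r1 q
... | r1 q = r2 q
... | r2 q = r3 q
... | r3 q = r0 (suc q)

data Parity : ℕ → Set where
  even : ∀ u → Parity (u * 2)
  odd  : ∀ u → Parity (1 + u * 2)

parity : ∀ n → Parity n
parity zero = even 0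
parity (suc n) with parity n
... | even u = odd u
... | odd u = even (suc u)

shift-in-block : ∀ r q s → r + q * 4 + s ≡ r + s + q * 4
shift-in-block = solve-∀

add-blocks : ∀ r q s l → r + q * 4 + (s + l * 4) ≡ r + s + (q + l) * 4
add-blocks = solve-∀

neg : Letter → Letter
neg a = b
neg b = a

neg-irreflexive : ∀ x → ¬ neg x ≡ x
neg-irreflexive a ()
neg-irreflexive b ()

neg-injective : ∀ {x y} → neg x ≡ neg y → x ≡ y
neg-injective {a} {a} _ = refl
neg-injective {b} {b} _ = refl
neg-injective {a} {b} ()
neg-injective {b} {a} ()

neg-involutive : ∀ x → neg (neg x) ≡ x
neg-involutive a = refl
neg-involutive b = refl

μ-letters : ∀ x → μ x ≡ x ∷ neg x ∷ neg x ∷ x ∷ []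
μ-letters a = refl
μ-letters b = refl

μ-palindrome : ∀ x → reverse (μ x) ≡ μ x
μ-palindrome a = refl
μ-palindrome b = refl

_≟L_ : (x y : Letter) → Dec (x ≡ y)
a ≟L a = yes refl
b ≟L b = yes refl
a ≟L b = no λ ()
b ≟L a = no λ ()

module _ {A : Set} where

  !!-++ˡ : ∀ (u v : List A) {n} → n < length u → (u ++ v) !! n ≡ u !! n
  !!-++ˡ (x ∷ u) v {zero} _ = refl
  !!-++ˡ (x ∷ u) v {suc n} (s≤s n<u) = !!-++ˡ u v n<u

  !!-++ʳ : ∀ (u v : List A) n → (u ++ v) !! (length u + n) ≡ v !! n
  !!-++ʳ [] v n = refl
  !!-++ʳ (x ∷ u) v n = !!-++ʳ u v n

  !!-just⇒< : ∀ (u : List A) n {x} → u !! n ≡ just x → n < length u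
  !!-just⇒< (y ∷ u) zero _ = s≤s z≤n
  !!-just⇒< (y ∷ u) (suc n) e = s≤s (!!-just⇒< u n e)

  !!-<⇒just : ∀ (u : List A) {n} → n < length u → ∃[ x ] u !! n ≡ just x
  !!-<⇒just (y ∷ u) {zero} _ = y , refl
  !!-<⇒just (y ∷ u) {suc n} (s≤s n<u) = !!-<⇒just u n<u

  !!-beyond : ∀ (u : List A) n → length u ≤ n → u !! n ≡ nothing
  !!-beyond [] n _ = refl
  !!-beyond (x ∷ u) (suc n) (s≤s u≤n) = !!-beyond u n u≤n

  !!-ext : ∀ (u v : List A) → (∀ n → u !! n ≡ v !! n) → u ≡ v
  !!-ext [] [] _ = refl
  !!-ext [] (y ∷ v) h with h 0
  ... | ()
  !!-ext (x ∷ u) [] h with h 0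
  ... | ()
  !!-ext (x ∷ u) (y ∷ v) h = cong₂ _∷_ (just-injective (h 0)) (!!-ext u v (h ∘ suc))

  !!-reverse : ∀ (w : List A) x y → suc (x + y) ≡ length w → reverse w !! x ≡ w !! y
  !!-reverse (z ∷ w) x zero e = begin
    reverse (z ∷ w) !! x                               ≡⟨ cong (_!! x) (unfold-reverse z w) ⟩
    (reverse w ++ z ∷ []) !! x                         ≡⟨ cong ((reverse w ++ z ∷ []) !!_) x≡ ⟩
    (reverse w ++ z ∷ []) !! (length (reverse w) + 0) ≡⟨ !!-++ʳ (reverse w) (z ∷ []) 0 ⟩
    just z                                             ∎
    where
    open ≡-Reasoning
    x≡ : x ≡ length (reverse w) + 0
    x≡ = trans (sym (+-identityʳ x))
           (trans (suc-injective e) (trans (sym (length-reverse w)) (sym (+-identityʳ _))))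
  !!-reverse (z ∷ w) x (suc y) e = begin
    reverse (z ∷ w) !! x       ≡⟨ cong (_!! x) (unfold-reverse z w) ⟩
    (reverse w ++ z ∷ []) !! x ≡⟨ !!-++ˡ (reverse w) (z ∷ []) x<w ⟩
    reverse w !! x             ≡⟨ !!-reverse w x y e′ ⟩
    w !! y                     ∎
    where
    open ≡-Reasoning
    e′ : suc (x + y) ≡ length w
    e′ = suc-injective (trans (cong suc (sym (+-suc x y))) e)
    x<w : x < length (reverse w)
    x<w = subst (x <_) (sym (length-reverse w)) (≤-trans (s≤s (m≤m+n x y)) (≤-reflexive e′))

  Mirror : List A → Set
  Mirror w = ∀ x y → suc (x + y) ≡ length w → w !! x ≡ w !! y

  palindrome⇒mirror : ∀ w → reverse w ≡ w → Mirror w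
  palindrome⇒mirror w p x y e = trans (cong (_!! x) (sym p)) (!!-reverse w x y e)

  mirror⇒palindrome : ∀ w → Mirror w → reverse w ≡ w
  mirror⇒palindrome w m = !!-ext (reverse w) w same
    where
    same : ∀ x → reverse w !! x ≡ w !! x
    same x with x <? length w
    ... | yes x<w = trans (!!-reverse w x y e) (sym (m x y e))
      where
      y = length w ∸ suc x
      e : suc (x + y) ≡ length w
      e = m+[n∸m]≡n x<w
    ... | no x≮w = trans (!!-beyond (reverse w) x (subst (_≤ x) (sym (length-reverse w)) w≤x))
                         (sym (!!-beyond w x w≤x))
      where
      w≤x = ≮⇒≥ x≮w

-- The Thue–Morse word: μ^k(a) is a prefix of μ^(k+1)(a), so letters of
-- iterates never change and t(n) may be read off from any iterate.
iter-prefix : ∀ k → ∃[ v ] iter (suc k) ≡ iter k ++ v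
iter-prefix zero = _ , refl
iter-prefix (suc k) with iter-prefix k
... | v , e = μ* v , trans (cong μ* e) (concatMap-++ μ (iter k) v)

iter-stable : ∀ d k {n x} → iter k !! n ≡ just x → iter (d + k) !! n ≡ just x
iter-stable zero k e = e
iter-stable (suc d) k {n} e with iter-prefix (d + k)
... | v , grow = trans (cong (_!! n) grow) (trans (!!-++ˡ (iter (d + k)) v (!!-just⇒< (iter (d + k)) n e′)) e′)
  where
  e′ = iter-stable d k e

length-μ* : ∀ w → length (μ* w) ≡ length w * 4
length-μ* [] = refl
length-μ* (a ∷ w) = cong (4 +_) (length-μ* w)
length-μ* (b ∷ w) = cong (4 +_) (length-μ* w)

length-iter : ∀ k → k < length (iter k)
length-iter zero = s≤s z≤n
length-iter (suc k) = subst (suc k <_) (sym (length-μ* (iter k)))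
  (≤-<-trans (length-iter k) (m<m*n _ 4 {{>-nonZero (≤-<-trans z≤n (length-iter k))}} (s≤s (s≤s z≤n))))

t-def : ∀ n {x} → iter (suc n) !! n ≡ just x → t n ≡ x
t-def n e with iter (suc n) !! n
t-def n refl | just _ = refl

t-at : ∀ n → iter (suc n) !! n ≡ just (t n)
t-at n with !!-<⇒just (iter (suc n)) (<-trans (n<1+n n) (length-iter (suc n)))
... | x , e = trans e (cong just (sym (t-def n e)))

t-spec : ∀ k n {x} → iter k !! n ≡ just x → t n ≡ x
t-spec k n {x} e = just-injective (trans (sym late-t) late-x)
  where
  late-t : iter (k + suc n) !! n ≡ just (t n)
  late-t = iter-stable k (suc n) (t-at n)
  late-x : iter (k + suc n) !! n ≡ just x
  late-x = subst (λ z → iter z !! n ≡ just x) (+-comm (suc n) k) (iter-stable (suc n) k e)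

μ-head : ∀ y (v : List Letter) {r} → r < 4 → (μ y ++ v) !! r ≡ μ y !! r
μ-head a v r<4 = !!-++ˡ (μ a) v r<4
μ-head b v r<4 = !!-++ˡ (μ b) v r<4

μ-skip : ∀ y (v : List Letter) n → (μ y ++ v) !! (4 + n) ≡ v !! n
μ-skip a v n = refl
μ-skip b v n = refl

μ*-!! : ∀ w q r {x} → r < 4 → w !! q ≡ just x → μ* w !! (r + q * 4) ≡ μ x !! r
μ*-!! (y ∷ w) zero r r<4 refl =
  trans (cong ((μ y ++ μ* w) !!_) (+-identityʳ r)) (μ-head y (μ* w) r<4)
μ*-!! (y ∷ w) (suc q) r r<4 e =
  trans (cong ((μ y ++ μ* w) !!_) (+-comm r (suc q * 4)))
    (trans (μ-skip y (μ* w) (q * 4 + r))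
      (trans (cong (μ* w !!_) (+-comm (q * 4) r)) (μ*-!! w q r r<4 e)))

t-μ : ∀ q r {x} → r < 4 → μ (t q) !! r ≡ just x → t (r + q * 4) ≡ x
t-μ q r r<4 e = t-spec (suc (suc q)) (r + q * 4) (trans (μ*-!! (iter (suc q)) q r r<4 (t-at q)) e)

t-4q : ∀ q → t (q * 4) ≡ t q
t-4q q = t-μ q 0 0<4 (cong (_!! 0) (μ-letters (t q)))

t-4q+1 : ∀ q → t (1 + q * 4) ≡ neg (t q)
t-4q+1 q = t-μ q 1 1<4 (cong (_!! 1) (μ-letters (t q)))

t-4q+2 : ∀ q → t (2 + q * 4) ≡ neg (t q)
t-4q+2 q = t-μ q 2 2<4 (cong (_!! 2) (μ-letters (t q)))

t-4q+3 : ∀ q → t (3 + q * 4) ≡ t q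
t-4q+3 q = t-μ q 3 3<4 (cong (_!! 3) (μ-letters (t q)))

t-odd : ∀ p → t (1 + p * 2) ≡ neg (t (p * 2))
t-odd p with parity p
... | even u rewrite *-assoc u 2 2 = trans (t-4q+1 u) (cong neg (sym (t-4q u)))
... | odd u rewrite *-assoc u 2 2 =
  trans (t-4q+3 u) (sym (trans (cong neg (t-4q+2 u)) (neg-involutive (t u))))

seg : ℕ → ℕ → List Letter
seg i zero = []
seg i (suc L) = t i ∷ seg (suc i) L

length-seg : ∀ i L → length (seg i L) ≡ L
length-seg i zero = refl
length-seg i (suc L) = cong suc (length-seg (suc i) L)

seg-!! : ∀ i L {x} → x < L → seg i L !! x ≡ just (t (i + x))
seg-!! i (suc L) {zero} _ = cong (just ∘ t) (sym (+-identityʳ i))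
seg-!! i (suc L) {suc x} (s≤s x<L) = trans (seg-!! (suc i) L x<L) (cong (just ∘ t) (sym (+-suc i x)))

seg-++ : ∀ i m n → seg i (m + n) ≡ seg i m ++ seg (i + m) n
seg-++ i zero n = cong (λ k → seg k n) (sym (+-identityʳ i))
seg-++ i (suc m) n =
  cong (t i ∷_) (trans (seg-++ (suc i) m n) (cong (λ k → seg (suc i) m ++ seg k n) (sym (+-suc i m))))

prefix-seg : ∀ n → prefix n ≡ seg 0 n
prefix-seg n = listing id 0 n (λ _ → refl)
  where
  listing : ∀ f i n → (∀ x → f x ≡ i + x) → map t (applyUpTo f n) ≡ seg i n
  listing f i zero h = refl
  listing f i (suc n) h = cong₂ _∷_ (cong t (trans (h 0) (+-identityʳ i)))
    (listing (f ∘ suc) (suc i) n (λ x → trans (h (suc x)) (+-suc i x)))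

seg-μ : ∀ i L → seg (i * 4) (L * 4) ≡ μ* (seg i L)
seg-μ i zero = refl
seg-μ i (suc L) = cong₂ _++_ block (seg-μ (suc i) L)
  where
  block : t (i * 4) ∷ t (1 + i * 4) ∷ t (2 + i * 4) ∷ t (3 + i * 4) ∷ [] ≡ μ (t i)
  block rewrite t-4q i | t-4q+1 i | t-4q+2 i | t-4q+3 i = sym (μ-letters (t i))

-- μ* commutes with reversal, since every μ(x) is a palindrome.
reverse-μ* : ∀ w → reverse (μ* w) ≡ μ* (reverse w)
reverse-μ* [] = refl
reverse-μ* (x ∷ w) = begin
  reverse (μ x ++ μ* w)           ≡⟨ reverse-++ (μ x) (μ* w) ⟩
  reverse (μ* w) ++ reverse (μ x) ≡⟨ cong₂ _++_ (reverse-μ* w) (μ-palindrome x) ⟩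
  μ* (reverse w) ++ μ x           ≡⟨ cong (μ* (reverse w) ++_) (sym (++-identityʳ (μ x))) ⟩
  μ* (reverse w) ++ μ* (x ∷ [])   ≡⟨ sym (concatMap-++ μ (reverse w) (x ∷ [])) ⟩
  μ* (reverse w ++ x ∷ [])        ≡⟨ cong μ* (sym (unfold-reverse x w)) ⟩
  μ* (reverse (x ∷ w))            ∎
  where open ≡-Reasoning

record Pal (i L : ℕ) : Set where
  constructor mkPal
  field mirror : ∀ x y → suc (x + y) ≡ L → t (i + x) ≡ t (i + y)
open Pal

mirror-at : ∀ {i L} → Pal i L → ∀ x y → suc (x + y) ≡ L → ∀ {u v} → i + x ≡ u → i + y ≡ v → t u ≡ t v
mirror-at p x y e refl refl = mirror p x y e

mirror-bounds : ∀ {x y L} → suc (x + y) ≡ L → x < L × y < L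
mirror-bounds {x} {y} refl = s≤s (m≤m+n x y) , s≤s (m≤n+m y x)

pal⇒palindrome : ∀ {i L} → Pal i L → Palindrome (seg i L)
pal⇒palindrome {i} {L} p = mirror⇒palindrome (seg i L) mirrored
  where
  mirrored : Mirror (seg i L)
  mirrored x y e with mirror-bounds (trans e (length-seg i L))
  ... | x<L , y<L = trans (seg-!! i L x<L)
    (trans (cong just (mirror p x y (trans e (length-seg i L)))) (sym (seg-!! i L y<L)))

palindrome⇒pal : ∀ {i L} → Palindrome (seg i L) → Pal i L
palindrome⇒pal {i} {L} p = mkPal mirrored
  where
  mirrored : ∀ x y → suc (x + y) ≡ L → t (i + x) ≡ t (i + y)
  mirrored x y e with mirror-bounds e
  ... | x<L , y<L = just-injective (trans (sym (seg-!! i L x<L))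
    (trans (palindrome⇒mirror (seg i L) p x y (trans e (sym (length-seg i L)))) (seg-!! i L y<L)))

pal? : ∀ i L → Dec (Pal i L)
pal? i L = map′ palindrome⇒pal pal⇒palindrome (list-≟ _≟L_ (reverse (seg i L)) (seg i L))

pal-empty : ∀ i → Pal i 0
pal-empty i = mkPal λ x y ()

pal-letter : ∀ i → Pal i 1
pal-letter i = mkPal λ { zero zero _ → refl ; zero (suc y) () ; (suc x) y () }

shrink : ∀ {i L} → Pal i L → ∀ d {L′} → d + L′ + d ≡ L → Pal (d + i) L′
shrink {i} p d {L′} refl = mkPal λ x y e →
  mirror-at p (d + x) (d + y) (trans (length-eq d x y) (cong (λ k → d + k + d) e)) (pos x) (pos y)
  where
  length-eq : ∀ d x y → suc (d + x + (d + y)) ≡ d + suc (x + y) + d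
  length-eq = solve-∀
  pos-eq : ∀ i d x → i + (d + x) ≡ d + i + x
  pos-eq = solve-∀
  pos = pos-eq i d

Pal-μ : ∀ {i L} → Pal i L → Pal (i * 4) (L * 4)
Pal-μ {i} {L} p = palindrome⇒pal (begin
  reverse (seg (i * 4) (L * 4)) ≡⟨ cong reverse (seg-μ i L) ⟩
  reverse (μ* (seg i L))        ≡⟨ reverse-μ* (seg i L) ⟩
  μ* (reverse (seg i L))        ≡⟨ cong μ* (pal⇒palindrome p) ⟩
  μ* (seg i L)                  ≡⟨ sym (seg-μ i L) ⟩
  seg (i * 4) (L * 4)           ∎)
  where open ≡-Reasoning

Pal-μ-trim₁ : ∀ {i l} → Pal i (suc l) → Pal (1 + i * 4) (2 + l * 4)
Pal-μ-trim₁ {l = l} p = shrink (Pal-μ p) 1 (cong suc (+-comm (2 + l * 4) 1))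

Pal-μ-trim₂ : ∀ {i l} → Pal i (suc l) → Pal (2 + i * 4) (l * 4)
Pal-μ-trim₂ {l = l} p = shrink (Pal-μ p) 2 (cong (2 +_) (+-comm (l * 4) 2))

-- An even-length palindrome t[i, i + 2d + 2) has its centre right after an
-- odd position: i + d is odd, as t(2p) ≠ t(2p + 1).
even-pal-centre : ∀ {i L} d → Pal i L → d + 2 + d ≡ L → ∀ p → ¬ i + d ≡ p * 2
even-pal-centre {i} d pal e p centre = neg-irreflexive (t (p * 2)) (sym (begin
  t (p * 2)       ≡⟨ mirror-at pal d (suc d) (trans (length-eq d) e) centre (trans (+-suc i d) (cong suc centre)) ⟩
  t (1 + p * 2)   ≡⟨ t-odd p ⟩
  neg (t (p * 2)) ∎))
  where
  open ≡-Reasoning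
  length-eq : ∀ d → suc (d + suc d) ≡ d + 2 + d
  length-eq = solve-∀

no-pal5 : ∀ {i} → ¬ Pal i 5
no-pal5 {i} p with mod4 i
... | r0 q = neg-irreflexive (t q) (begin
  neg (t q)    ≡⟨ sym (t-4q+1 q) ⟩
  t (1 + q * 4) ≡⟨ mirror-at p 1 3 refl (shift-in-block 0 q 1) (shift-in-block 0 q 3) ⟩
  t (3 + q * 4) ≡⟨ t-4q+3 q ⟩
  t q           ∎)
  where open ≡-Reasoning
... | r1 q = neg-irreflexive (t q) (begin
  neg (t q)        ≡⟨ sym (t-4q+2 q) ⟩
  t (2 + q * 4)    ≡⟨ mirror-at p 1 3 refl (shift-in-block 1 q 1) (shift-in-block 1 q 3) ⟩
  t (suc q * 4)    ≡⟨ t-4q (suc q) ⟩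
  t (suc q)        ≡⟨ sym (neg-injective (begin
    neg (t q)            ≡⟨ sym (t-4q+1 q) ⟩
    t (1 + q * 4)        ≡⟨ mirror-at p 0 4 refl (shift-in-block 1 q 0) (shift-in-block 1 q 4) ⟩
    t (1 + suc q * 4)    ≡⟨ t-4q+1 (suc q) ⟩
    neg (t (suc q))      ∎)) ⟩
  t q              ∎)
  where open ≡-Reasoning
... | r2 q = neg-irreflexive (t (suc q)) (begin
  neg (t (suc q))   ≡⟨ sym (t-4q+1 (suc q)) ⟩
  t (1 + suc q * 4) ≡⟨ sym (mirror-at p 1 3 refl (shift-in-block 2 q 1) (shift-in-block 2 q 3)) ⟩
  t (3 + q * 4)     ≡⟨ t-4q+3 q ⟩
  t q               ≡⟨ neg-injective (begin
    neg (t q)             ≡⟨ sym (t-4q+2 q) ⟩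
    t (2 + q * 4)         ≡⟨ mirror-at p 0 4 refl (shift-in-block 2 q 0) (shift-in-block 2 q 4) ⟩
    t (2 + suc q * 4)     ≡⟨ t-4q+2 (suc q) ⟩
    neg (t (suc q))       ∎) ⟩
  t (suc q)         ∎)
  where open ≡-Reasoning
... | r3 q = neg-irreflexive (t (suc q)) (sym (begin
  t (suc q)         ≡⟨ sym (t-4q (suc q)) ⟩
  t (suc q * 4)     ≡⟨ mirror-at p 1 3 refl (shift-in-block 3 q 1) (shift-in-block 3 q 3) ⟩
  t (2 + suc q * 4) ≡⟨ t-4q+2 (suc q) ⟩
  neg (t (suc q))   ∎))
  where open ≡-Reasoning

data Shape : ℕ → ℕ → Set where
  empty   : ∀ i → Shape i 0
  single  : ∀ i → Shape i 1
  triple₂ : ∀ q → Shape (2 + q * 4) 3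
  triple₃ : ∀ q → Shape (3 + q * 4) 3
  even4₀  : ∀ q l → Shape (q * 4) (suc l * 4)
  even4₂  : ∀ q l → Shape (2 + q * 4) (suc l * 4)
  even2₁  : ∀ q l → Shape (1 + q * 4) (2 + l * 4)
  even2₃  : ∀ q l → Shape (3 + q * 4) (2 + l * 4)

halves-4l : ∀ l → suc (l * 2) + 2 + suc (l * 2) ≡ suc l * 4
halves-4l = solve-∀

halves-4l+2 : ∀ l → l * 2 + 2 + l * 2 ≡ 2 + l * 4
halves-4l+2 = solve-∀

centre-4l : ∀ r q l → r + q * 4 + suc (l * 2) ≡ suc r + (q * 2 + l) * 2
centre-4l = solve-∀

centre-4l+2 : ∀ r q l → r + q * 4 + l * 2 ≡ r + (q * 2 + l) * 2
centre-4l+2 = solve-∀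

-- Length 4l + 4: the centre i + 2l + 1 is odd, so the position i is even.
shape-length-4l : ∀ {i l} → Pal i (suc l * 4) → Shape i (suc l * 4)
shape-length-4l {i} {l} p with mod4 i
... | r0 q = even4₀ q l
... | r2 q = even4₂ q l
... | r1 q = ⊥-elim (even-pal-centre (suc (l * 2)) p (halves-4l l) (1 + q * 2 + l) (centre-4l 1 q l))
... | r3 q = ⊥-elim (even-pal-centre (suc (l * 2)) p (halves-4l l) (2 + q * 2 + l) (centre-4l 3 q l))

-- Length 4l + 2: the centre i + 2l is odd, so the position i is odd.
shape-length-4l+2 : ∀ {i l} → Pal i (2 + l * 4) → Shape i (2 + l * 4)
shape-length-4l+2 {i} {l} p with mod4 i
... | r1 q = even2₁ q l
... | r3 q = even2₃ q l
... | r0 q = ⊥-elim (even-pal-centre (l * 2) p (halves-4l+2 l) (q * 2 + l) (centre-4l+2 0 q l))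
... | r2 q = ⊥-elim (even-pal-centre (l * 2) p (halves-4l+2 l) (1 + q * 2 + l) (centre-4l+2 2 q l))

-- Length 3 at a position 4q or 4q + 1 would need t(4q) = t(4q + 2) or
-- t(4q + 1) = t(4q + 3).
shape-length-3 : ∀ {i} → Pal i 3 → Shape i 3
shape-length-3 {i} p with mod4 i
... | r2 q = triple₂ q
... | r3 q = triple₃ q
... | r0 q = ⊥-elim (neg-irreflexive (t q) (sym (begin
  t q           ≡⟨ sym (t-4q q) ⟩
  t (q * 4)     ≡⟨ mirror-at p 0 2 refl (shift-in-block 0 q 0) (shift-in-block 0 q 2) ⟩
  t (2 + q * 4) ≡⟨ t-4q+2 q ⟩
  neg (t q)     ∎)))
  where open ≡-Reasoning
... | r1 q = ⊥-elim (neg-irreflexive (t q) (begin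
  neg (t q)     ≡⟨ sym (t-4q+1 q) ⟩
  t (1 + q * 4) ≡⟨ mirror-at p 0 2 refl (shift-in-block 1 q 0) (shift-in-block 1 q 2) ⟩
  t (3 + q * 4) ≡⟨ t-4q+3 q ⟩
  t q           ∎))
  where open ≡-Reasoning

-- Every palindromic factor has one of the shapes above; odd lengths beyond 3
-- are excluded as they contain a central palindrome of length 5.
shape : ∀ {i L} → Pal i L → Shape i L
shape {i} {L} p with mod4 L
... | r0 zero = empty i
... | r0 (suc l) = shape-length-4l {l = l} p
... | r1 zero = single i
... | r1 (suc l) = ⊥-elim (no-pal5 (shrink p (l * 2) (around l)))
  where
  around : ∀ l → l * 2 + 5 + l * 2 ≡ 1 + suc l * 4
  around = solve-∀
... | r2 l = shape-length-4l+2 {l = l} p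
... | r3 zero = shape-length-3 p
... | r3 (suc l) = ⊥-elim (no-pal5 (shrink p (suc (l * 2)) (around l)))
  where
  around : ∀ l → suc (l * 2) + 5 + suc (l * 2) ≡ 3 + suc l * 4
  around = solve-∀

-- Palindromes at the aligned shapes come from palindromes one level down:
-- reading the mirror property of the long palindrome at the first letter of
-- each μ-block gives the mirror property of the short one.
descend₀ : ∀ {q l} → Pal (q * 4) (l * 4) → Pal q l
descend₀ {q} {l} p = mkPal λ x y e → begin
  t (q + x)           ≡⟨ sym (t-4q (q + x)) ⟩
  t ((q + x) * 4)     ≡⟨ mirror-at p (x * 4) (3 + y * 4) (trans (length-eq x y) (cong (_* 4) e))
                                     (add-blocks 0 q 0 x) (add-blocks 0 q 3 y) ⟩
  t (3 + (q + y) * 4) ≡⟨ t-4q+3 (q + y) ⟩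
  t (q + y)           ∎
  where
  open ≡-Reasoning
  length-eq : ∀ x y → suc (x * 4 + (3 + y * 4)) ≡ suc (x + y) * 4
  length-eq = solve-∀

-- At position 4q + 1 the first letters of the blocks are complemented.
descend₁ : ∀ {q l} → Pal (1 + q * 4) (2 + l * 4) → Pal q (suc l)
descend₁ {q} {l} p = mkPal λ x y e → neg-injective (begin
  neg (t (q + x))     ≡⟨ sym (t-4q+1 (q + x)) ⟩
  t (1 + (q + x) * 4) ≡⟨ mirror-at p (x * 4) (1 + y * 4)
                           (trans (length-eq x y) (cong (λ k → 2 + k * 4) (suc-injective e)))
                           (add-blocks 1 q 0 x) (add-blocks 1 q 1 y) ⟩
  t (2 + (q + y) * 4) ≡⟨ t-4q+2 (q + y) ⟩
  neg (t (q + y))     ∎)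
  where
  open ≡-Reasoning
  length-eq : ∀ x y → suc (x * 4 + (1 + y * 4)) ≡ 2 + (x + y) * 4
  length-eq = solve-∀

descend₃ : ∀ {q l} → Pal (3 + q * 4) (2 + l * 4) → Pal (suc q) l
descend₃ {l = l} p = descend₀ (shrink p 1 (cong suc (+-comm (l * 4) 1)))

descend₂-inner : ∀ {q l} → Pal (2 + q * 4) (suc l * 4) → Pal (suc q) l
descend₂-inner {l = l} p = descend₀ (shrink p 2 (cong (2 +_) (+-comm (l * 4) 2)))

-- A palindrome at a position ≡ 2 also extends one letter beyond its
-- μ-blocks on both sides, giving a palindrome starting at the block q.
descend₂-outer : ∀ {q l} → Pal (2 + q * 4) (suc l * 4) → Pal q (2 + l)
descend₂-outer {q} {l} p = mkPal mirrored
  where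
  open ≡-Reasoning
  length-eq : ∀ x y → suc (x * 4 + (3 + y * 4)) ≡ suc (x + y) * 4
  length-eq = solve-∀
  shifted : ∀ x y → x + y ≡ l → t (q + x) ≡ t (q + suc y)
  shifted x y e = neg-injective (begin
    neg (t (q + x))         ≡⟨ sym (t-4q+2 (q + x)) ⟩
    t (2 + (q + x) * 4)     ≡⟨ mirror-at p (x * 4) (3 + y * 4) (trans (length-eq x y) (cong (λ k → suc k * 4) e))
                                 (add-blocks 2 q 0 x) (add-blocks 2 q 3 y) ⟩
    t (1 + suc (q + y) * 4) ≡⟨ t-4q+1 (suc (q + y)) ⟩
    neg (t (suc (q + y)))   ≡⟨ cong (neg ∘ t) (sym (+-suc q y)) ⟩
    neg (t (q + suc y))     ∎)
  mirrored : ∀ x y → suc (x + y) ≡ 2 + l → t (q + x) ≡ t (q + y)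
  mirrored x zero e = trans (cong (λ k → t (q + k)) x≡) (sym (shifted 0 l refl))
    where
    x≡ : x ≡ suc l
    x≡ = trans (sym (+-identityʳ x)) (suc-injective e)
  mirrored x (suc y) e = shifted x y (suc-injective (trans (sym (+-suc x y)) (suc-injective e)))

-- Fac N j: the prefix of t of length N is a concatenation of j palindromic
-- factors t[i, i + L), empty factors allowed.
infixl 5 _▸_
data Fac : ℕ → ℕ → Set where
  ε   : ∀ {j} → Fac 0 j
  _▸_ : ∀ {i L j} → Fac i j → Pal i L → Fac (i + L) (suc j)

cast : ∀ {N M j} → N ≡ M → Fac N j → Fac M j
cast refl f = f

Fac-0 : ∀ {N} → Fac N 0 → N ≡ 0
Fac-0 ε = refl

pad : ∀ {N j} → Fac N j → Fac N (suc j)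
pad {N} f = cast (+-identityʳ N) (f ▸ pal-empty N)

pads : ∀ {N j} k → Fac N j → Fac N (k + j)
pads zero f = f
pads (suc k) f = pad (pads k f)

pad-≤ : ∀ {N j j′} → j ≤ j′ → Fac N j → Fac N j′
pad-≤ {N} j≤j′ f = subst (Fac N) (m∸n+n≡m j≤j′) (pads _ f)

extend : ∀ {N j} → Fac N j → Fac (suc N) (suc j)
extend {N} f = cast (+-comm N 1) (f ▸ pal-letter N)

-- Lifting: the prefix of length 4m + r is covered by the images of the
-- factors of a prefix one level down, plus at most two single letters.
lift₀ : ∀ {m j} → Fac m j → Fac (m * 4) j
lift₀ ε = ε
lift₀ (_▸_ {i} {L} f p) = cast (sym (*-distribʳ-+ 4 i L)) (lift₀ f ▸ Pal-μ p)

lift₁ : ∀ {m j} → Fac m j → Fac (1 + m * 4) (suc j)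
lift₁ f = extend (lift₀ f)

lift₂ : ∀ {m j} → Fac m j → Fac (2 + m * 4) (2 + j)
lift₂ f = extend (extend (lift₀ f))

-- From the prefix of length m + 1: the last nonempty factor lifts to a
-- trimmed image ending at 4m + 3 (resp. 4m + 2).
last-nonempty : ∀ {i l m} → i + suc l ≡ suc m → i + l ≡ m
last-nonempty {i} {l} e = suc-injective (trans (sym (+-suc i _)) e)

lift₃ : ∀ {m j} → Fac (suc m) j → Fac (3 + m * 4) (suc j)
lift₃ {m} f = go f refl
  where
  go : ∀ {N j} → Fac N j → N ≡ suc m → Fac (3 + m * 4) (suc j)
  go (_▸_ {i} {zero} f p) e = pad (go f (trans (sym (+-identityʳ i)) e))
  go (_▸_ {i} {suc l} f p) e =
    cast (trans (add-blocks 1 i 2 l) (cong (λ k → 3 + k * 4) (last-nonempty e)))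
      (lift₁ f ▸ Pal-μ-trim₁ p)

lift₂′ : ∀ {m j} → Fac (suc m) j → Fac (2 + m * 4) (2 + j)
lift₂′ {m} f = go f refl
  where
  go : ∀ {N j} → Fac N j → N ≡ suc m → Fac (2 + m * 4) (2 + j)
  go (_▸_ {i} {zero} f p) e = pad (go f (trans (sym (+-identityʳ i)) e))
  go (_▸_ {i} {suc l} f p) e =
    cast (trans (add-blocks 2 i 0 l) (cong (λ k → 2 + k * 4) (last-nonempty e)))
      (lift₂ f ▸ Pal-μ-trim₂ p)

-- Descent: what a factorization of the prefix of length r + 4m (r < 4) into
-- j palindromes yields one level down.
Descent : ℕ → ℕ → ℕ → Set
Descent 0 m j = Fac m j
Descent 1 m j = ∃[ i ] j ≡ suc i × Fac m i
Descent 2 m j = ∃[ i ] j ≡ 2 + i × (Fac m i ⊎ Fac (suc m) i)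
Descent 3 m j = ∃[ i ] j ≡ suc i × Fac (suc m) i
Descent _ _ _ = ⊥

descent-pad : ∀ r {m j} → Descent r m j → Descent r m (suc j)
descent-pad 0 f = pad f
descent-pad 1 (i , refl , f) = suc i , refl , pad f
descent-pad 2 (i , refl , f) = suc i , refl , ⊎-map pad pad f
descent-pad 3 (i , refl , f) = suc i , refl , pad f

last-letter : ∀ {i k} → i + 1 ≡ suc k → i ≡ k
last-letter {i} e = suc-injective (trans (+-comm 1 i) e)

descend : ∀ {N j} r m → r < 4 → N ≡ r + m * 4 → Fac N j → Descent r m j
descend-last : ∀ {i L j} r m → r < 4 → i + L ≡ r + m * 4 → Fac i j → Shape i L → Pal i L →
               Descent r m (suc j)

descend r m r<4 e ε with div4-unique {0} {r} {0} {m} 0<4 r<4 e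
... | refl , refl = ε
descend r m r<4 e (f ▸ p) = descend-last r m r<4 e f (shape p) p

descend-last r m r<4 e f (empty i) p = descent-pad r (descend r m r<4 (trans (sym (+-identityʳ i)) e) f)
descend-last 0 zero _ e f (single i) p = contradiction (trans (+-comm 1 i) e) 1+n≢0
descend-last 0 (suc m) _ e f (single i) p with descend 3 m 3<4 (last-letter e) f
... | _ , refl , g = pad (pad g)
descend-last 1 m _ e f (single i) p = _ , refl , descend 0 m 0<4 (last-letter e) f
descend-last 2 m _ e f (single i) p with descend 1 m 1<4 (last-letter e) f
... | _ , refl , g = _ , refl , inj₁ g
descend-last 3 m _ e f (single i) p with descend 2 m 2<4 (last-letter e) f
... | _ , refl , inj₁ g = _ , refl , pad (extend g)
... | _ , refl , inj₂ g = _ , refl , pad (pad g)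
descend-last (suc (suc (suc (suc _)))) m (s≤s (s≤s (s≤s (s≤s ())))) e f (single i) p
descend-last r m r<4 e f (triple₂ q) p with div4-unique {1} {r} {suc q} {m} 1<4 r<4 (trans (sym (shift-in-block 2 q 3)) e)
... | refl , refl with descend 2 q 2<4 refl f
...   | _ , refl , inj₁ g = _ , refl , pad (extend g)
...   | _ , refl , inj₂ g = _ , refl , pad (pad g)
descend-last r m r<4 e f (triple₃ q) p with div4-unique {2} {r} {suc q} {m} 2<4 r<4 (trans (sym (shift-in-block 3 q 3)) e)
... | refl , refl with descend 3 q 3<4 refl f
...   | _ , refl , g = _ , refl , inj₁ g
descend-last r m r<4 e f (even4₀ q l) p with div4-unique {0} {r} {q + suc l} {m} 0<4 r<4 (trans (sym (add-blocks 0 q 0 (suc l))) e)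
... | refl , refl = descend 0 q 0<4 refl f ▸ descend₀ p
descend-last r m r<4 e f (even4₂ q l) p with div4-unique {2} {r} {q + suc l} {m} 2<4 r<4 (trans (sym (add-blocks 2 q 0 (suc l))) e)
... | refl , refl with descend 2 q 2<4 refl f
...   | _ , refl , inj₁ g = _ , refl , inj₂ (cast (+-suc q (suc l)) (g ▸ descend₂-outer p))
...   | _ , refl , inj₂ g = _ , refl , inj₁ (cast (sym (+-suc q l)) (g ▸ descend₂-inner p))
descend-last r m r<4 e f (even2₁ q l) p with div4-unique {3} {r} {q + l} {m} 3<4 r<4 (trans (sym (add-blocks 1 q 2 l)) e)
... | refl , refl with descend 1 q 1<4 refl f
...   | _ , refl , g = _ , refl , cast (+-suc q l) (g ▸ descend₁ p)
descend-last r m r<4 e f (even2₃ q l) p with div4-unique {1} {r} {suc (q + l)} {m} 1<4 r<4 (trans (sym (add-blocks 3 q 2 l)) e)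
... | refl , refl with descend 3 q 3<4 refl f
...   | _ , refl , g = _ , refl , g ▸ descend₃ p

split-seg : ∀ (u v : List Letter) i L → u ++ v ≡ seg i L →
  length u ≤ L × u ≡ seg i (length u) × v ≡ seg (i + length u) (L ∸ length u)
split-seg [] v i L e = z≤n , refl , trans e (cong (λ k → seg k L) (sym (+-identityʳ i)))
split-seg (x ∷ u) v i (suc L) e with ∷-injective e
... | refl , rest with split-seg u v (suc i) L rest
... | u≤L , u≡ , v≡ = s≤s u≤L , cong (t i ∷_) u≡ , trans v≡ (cong (λ k → seg k (L ∸ length u)) (sym (+-suc i (length u))))

fac-append : ∀ ws {i L k} → All Palindrome ws → concat ws ≡ seg i L → Fac i k → Fac (i + L) (k + length ws)
fac-append [] {i} {zero} {k} _ _ f = subst₂ Fac (sym (+-identityʳ i)) (sym (+-identityʳ k)) f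
fac-append (w ∷ ws) {i} {L} {k} (pw ∷ pws) e f with split-seg w (concat ws) i L e
... | w≤L , w≡ , rest≡ = subst₂ Fac ends (sym (+-suc k (length ws)))
  (fac-append ws pws rest≡ (f ▸ palindrome⇒pal (subst Palindrome w≡ pw)))
  where
  ends : i + length w + (L ∸ length w) ≡ i + L
  ends = trans (+-assoc i _ _) (cong (i +_) (m+[n∸m]≡n w≤L))

concat-empties : ∀ j → concat (replicate j ([] {A = Letter})) ≡ []
concat-empties zero = refl
concat-empties (suc j) = concat-empties j

fac-list : ∀ {N j} → Fac N j →
  Σ (List (List Letter)) λ ws → All Palindrome ws × concat ws ≡ seg 0 N × length ws ≡ j
fac-list {j = j} ε = replicate j [] , replicate⁺ j refl , concat-empties j , length-replicate j
fac-list (_▸_ {i} {L} f p) with fac-list f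
... | ws , pws , cws , lws = ws ++ seg i L ∷ [] , ++⁺ pws (pal⇒palindrome p ∷ []) , joined ,
  trans (length-++ ws) (trans (+-comm (length ws) 1) (cong suc lws))
  where
  open ≡-Reasoning
  joined : concat (ws ++ seg i L ∷ []) ≡ seg 0 (i + L)
  joined = begin
    concat (ws ++ seg i L ∷ [])  ≡⟨ sym (concat-++ ws (seg i L ∷ [])) ⟩
    concat ws ++ (seg i L ++ []) ≡⟨ cong₂ _++_ cws (++-identityʳ (seg i L)) ⟩
    seg 0 i ++ seg i L           ≡⟨ sym (seg-++ 0 i L) ⟩
    seg 0 (i + L)                ∎

fromPalFact : ∀ {N j} → PalFact (prefix N) j → Fac N j
fromPalFact {N} (ws , pws , cws , refl) = fac-append ws pws (trans cws (prefix-seg N)) ε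

toPalFact : ∀ {N j} → Fac N j → PalFact (prefix N) j
toPalFact {N} f with fac-list f
... | ws , pws , cws , lws = ws , pws , trans cws (sym (prefix-seg N)) , lws

-- Fac is decidable: search for the length of the last factor.
last-factor : ∀ {N j} → Fac N (suc j) → ∃[ L ] L < suc N × (Fac (N ∸ L) j × Pal (N ∸ L) L)
last-factor ε = 0 , s≤s z≤n , ε , pal-empty 0
last-factor (_▸_ {i} {L} f p) = L , s≤s (m≤n+m L i) , subst (λ n → Fac n _ × Pal n L) (sym (m+n∸n≡m i L)) (f , p)

fac? : ∀ N j → Dec (Fac N j)
fac? zero j = yes ε
fac? (suc N) zero = no (1+n≢0 ∘ Fac-0)
fac? N (suc j) = map′ build last-factor (anyUpTo? (λ L → fac? (N ∸ L) j ×-dec pal? (N ∸ L) L) (suc N))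
  where
  build : ∃[ L ] L < suc N × (Fac (N ∸ L) j × Pal (N ∸ L) L) → Fac N (suc j)
  build (L , s≤s L≤N , f , p) = cast (m∸n+n≡m L≤N) (f ▸ p)

ppl-minimal : ∀ {n k j} → PPL n k → Fac n j → k ≤ j
ppl-minimal (_ , least) f = least _ (toPalFact f)

mkPPL : ∀ {n k} → Fac n k → (∀ j → Fac n j → k ≤ j) → PPL n k
mkPPL f least = toPalFact f , λ j g → least j (fromPalFact g)

too-short : ∀ {m c} → PPL m (suc c) → ¬ Fac m c
too-short p f = 1+n≰n (ppl-minimal p f)

-- Below SP(c + 1) every prefix is a product of c palindromes: otherwise the
-- first prefix needing more would need exactly c + 1.
below-SP : ∀ c n → (∀ m → PPL m (suc c) → n ≤ m) → ∀ m → m < n → Fac m c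
below-SP c n least zero _ = ε
below-SP c n least (suc m) m<n with fac? (suc m) c
... | yes f = f
... | no ¬f = contradiction (least (suc m) (mkPPL (extend previous) needs)) (<⇒≱ m<n)
  where
  previous : Fac m c
  previous = below-SP c n least m (<-trans (n<1+n m) m<n)
  needs : ∀ j → Fac (suc m) j → suc c ≤ j
  needs j f with j ≤? c
  ... | yes j≤c = ⊥-elim (¬f (pad-≤ j≤c f))
  ... | no j≰c = ≰⇒> j≰c

SP-1 : SP 1 1
SP-1 = mkPPL (extend ε) needs , shortest
  where
  needs : ∀ j → Fac 1 j → 1 ≤ j
  needs zero f = contradiction (Fac-0 f) 1+n≢0
  needs (suc j) _ = s≤s z≤n
  shortest : ∀ m → PPL m 1 → 1 ≤ m
  shortest zero p = ⊥-elim (too-short p ε)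
  shortest (suc m) _ = s≤s z≤n

SP-2 : SP 2 2
SP-2 = mkPPL (extend (extend ε)) needs , shortest
  where
  needs : ∀ j → Fac 2 j → 2 ≤ j
  needs j f with descend 2 0 2<4 refl f
  ... | _ , refl , _ = s≤s (s≤s z≤n)
  shortest : ∀ m → PPL m 2 → 2 ≤ m
  shortest 0 p = ⊥-elim (too-short p ε)
  shortest 1 p = ⊥-elim (too-short p (extend ε))
  shortest (suc (suc m)) _ = s≤s (s≤s z≤n)

SP-3 : SP 3 6
SP-3 = mkPPL (lift₂ {1} (extend ε)) needs , shortest
  where
  needs : ∀ j → Fac 6 j → 3 ≤ j
  needs j f with descend 2 1 2<4 refl f
  ... | zero , refl , inj₁ g = contradiction (Fac-0 g) 1+n≢0
  ... | suc _ , refl , inj₁ _ = s≤s (s≤s (s≤s z≤n))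
  ... | _ , refl , inj₂ g with descend 2 0 2<4 refl g
  ...   | _ , refl , _ = s≤s (s≤s (s≤s z≤n))
  shortest : ∀ m → PPL m 3 → 6 ≤ m
  shortest 0 p = ⊥-elim (too-short p ε)
  shortest 1 p = ⊥-elim (too-short p (pad (extend ε)))
  shortest 2 p = ⊥-elim (too-short p (extend (extend ε)))
  shortest 3 p = ⊥-elim (too-short p (lift₃ {0} (extend ε)))
  shortest 4 p = ⊥-elim (too-short p (pad (lift₀ {1} (extend ε))))
  shortest 5 p = ⊥-elim (too-short p (lift₁ {1} (extend ε)))
  shortest (suc (suc (suc (suc (suc (suc m)))))) _ = s≤s (s≤s (s≤s (s≤s (s≤s (s≤s z≤n)))))

base16 : ∀ M → Σ ℕ λ s₁ → Σ ℕ λ s₂ → Σ ℕ λ q → s₁ < 4 × s₂ < 4 × M ≡ s₁ + (s₂ + q * 4) * 4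
base16 M = M % 4 , M / 4 % 4 , M / 4 / 4 , m%n<n M 4 , m%n<n (M / 4) 4 ,
  trans (m≡m%n+[m/n]*n M 4) (cong (λ k → M % 4 + k * 4) (m≡m%n+[m/n]*n (M / 4) 4))

-- Lifting twice costs at most three palindromes: the prefix of length
-- 16q + s is covered from the prefix of length q, or from that of length
-- q + 1 when the low digits s = s₁ + 4s₂ are at least 10.
lift-two-digits : ∀ {q c} s₁ s₂ → s₁ < 4 → s₂ < 4 → Fac q c → (10 ≤ s₁ + s₂ * 4 → Fac (suc q) c) →
  Fac (s₁ + (s₂ + q * 4) * 4) (3 + c)
lift-two-digits 0 0 _ _ f g = pads 3 (lift₀ (lift₀ f))
lift-two-digits 1 0 _ _ f g = pads 2 (lift₁ (lift₀ f))
lift-two-digits 2 0 _ _ f g = pads 1 (lift₂ (lift₀ f))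
lift-two-digits 3 0 _ _ f g = pads 1 (lift₃ (lift₁ f))
lift-two-digits 0 1 _ _ f g = pads 2 (lift₀ (lift₁ f))
lift-two-digits 1 1 _ _ f g = pads 1 (lift₁ (lift₁ f))
lift-two-digits 2 1 _ _ f g = lift₂ (lift₁ f)
lift-two-digits 3 1 _ _ f g = lift₃ (lift₂ f)
lift-two-digits 0 2 _ _ f g = pads 1 (lift₀ (lift₂ f))
lift-two-digits 1 2 _ _ f g = lift₁ (lift₂ f)
lift-two-digits 2 2 _ _ f g = lift₂′ (lift₃ (g ≤-refl))
lift-two-digits 3 2 _ _ f g = pads 1 (lift₃ (lift₃ (g (n≤1+n 10))))
lift-two-digits 0 3 _ _ f g = pads 2 (lift₀ (lift₃ (g (m≤m+n 10 2))))
lift-two-digits 1 3 _ _ f g = pads 1 (lift₁ (lift₃ (g (m≤m+n 10 3))))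
lift-two-digits 2 3 _ _ f g = pads 1 (lift₂′ (lift₀ (g (m≤m+n 10 4))))
lift-two-digits 3 3 _ _ f g = pads 2 (lift₃ (lift₀ (g (m≤m+n 10 5))))
lift-two-digits (suc (suc (suc (suc _)))) _ (s≤s (s≤s (s≤s (s≤s ())))) _ f g
lift-two-digits _ (suc (suc (suc (suc _)))) _ (s≤s (s≤s (s≤s (s≤s ())))) f g

-- Which quotients occur below 16n′ + 10 = 16 (n′ + 1) − 6.
digits-value : ∀ s₁ s₂ q → s₁ + (s₂ + q * 4) * 4 ≡ (s₁ + s₂ * 4) + q * 16
digits-value = solve-∀

quotient-≤ : ∀ s q n′ → s + q * 16 < 10 + n′ * 16 → q < suc n′
quotient-≤ s q n′ lt = *-cancelʳ-< 16 q (suc n′)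
  (≤-<-trans (m≤n+m (q * 16) s) (<-≤-trans lt (+-monoˡ-≤ (n′ * 16) (m≤m+n 10 6))))

quotient-< : ∀ s q n′ → 10 ≤ s → s + q * 16 < 10 + n′ * 16 → q < n′
quotient-< s q n′ 10≤s lt = *-cancelʳ-< 16 q n′
  (+-cancelˡ-< 10 (q * 16) (n′ * 16) (≤-<-trans (+-monoˡ-≤ (q * 16) 10≤s) lt))

plus-three : ∀ {u v} → u ≤ v → u + 3 ≤ 3 + v
plus-three {u} {v} u≤v = subst (u + 3 ≤_) (+-comm v 3) (+-monoˡ-≤ 3 u≤v)

-- The recurrence, for k = c + 1 and SP(k) = n′ + 1.
SP-step : ∀ c n′ → SP (suc c) (suc n′) → SP (suc c + 3) (2 + (2 + n′ * 4) * 4)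
SP-step c n′ (ppl , least) = mkPPL upper needs , shortest
  where
  N = 2 + (2 + n′ * 4) * 4
  lower-prefix : ∀ m → m < suc n′ → Fac m c
  lower-prefix = below-SP c (suc n′) least
  -- 16n − 6 is reached from n by the trimmed lifts, with three more factors.
  upper : Fac N (suc c + 3)
  upper = subst (Fac N) (sym (+-comm (suc c) 3)) (lift₂′ (lift₃ (fromPalFact (proj₁ ppl))))
  -- Descending twice from 16n − 6 lands on n − 1 or n, saving at most three factors.
  needs : ∀ j → Fac N j → suc c + 3 ≤ j
  needs j f with descend 2 (2 + n′ * 4) 2<4 refl f
  ... | _ , refl , inj₂ g with descend 3 n′ 3<4 refl g
  ...   | i , refl , h = plus-three (ppl-minimal ppl h)
  needs j f | _ , refl , inj₁ g with descend 2 n′ 2<4 refl g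
  ...   | i , refl , inj₁ h = plus-three (ppl-minimal ppl (extend h))
  ...   | i , refl , inj₂ h = ≤-trans (plus-three (ppl-minimal ppl h)) (n≤1+n _)
  -- Every shorter prefix lifts from a prefix shorter than n.
  short : ∀ M → M < N → Fac M (3 + c)
  short M M<N with base16 M
  ... | s₁ , s₂ , q , s₁<4 , s₂<4 , refl =
    lift-two-digits s₁ s₂ s₁<4 s₂<4 (lower-prefix q (quotient-≤ _ q n′ bound)) high
    where
    bound : (s₁ + s₂ * 4) + q * 16 < 10 + n′ * 16
    bound = subst₂ _<_ (digits-value s₁ s₂ q) (digits-value 2 2 n′) M<N
    high : 10 ≤ s₁ + s₂ * 4 → Fac (suc q) c
    high 10≤s = lower-prefix (suc q) (s≤s (quotient-< _ q n′ 10≤s bound))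
  shortest : ∀ M → PPL M (suc c + 3) → N ≤ M
  shortest M p with N ≤? M
  ... | yes N≤M = N≤M
  ... | no N≰M = ⊥-elim (1+n≰n (subst (suc c + 3 ≤_) (+-comm 3 c) (ppl-minimal p (short M (≰⇒> N≰M)))))

sixteen-n-6 : ∀ n′ → 16 * suc n′ ∸ 6 ≡ 2 + (2 + n′ * 4) * 4
sixteen-n-6 n′ = trans (cong (_∸ 6) (expand n′)) (m+n∸m≡n 6 _)
  where
  expand : ∀ n′ → 16 * suc n′ ≡ 6 + (2 + (2 + n′ * 4) * 4)
  expand = solve-∀

recurrence : ∀ (k n : ℕ) → 1 ≤ k → SP k n → SP (k + 3) (16 * n ∸ 6)
recurrence (suc c) zero _ (ppl , _) = ⊥-elim (too-short ppl ε)
recurrence (suc c) (suc n′) _ sp = subst (SP (suc c + 3)) (sym (sixteen-n-6 n′)) (SP-step c n′ sp)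

proposition15 : SP 1 1 × SP 2 2 × SP 3 6 ×
    (∀ (k n : ℕ) → 1 ≤ k → SP k n → SP (k + 3) (16 * n ∸ 6))
proposition15 = SP-1 , SP-2 , SP-3 , recurrence
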